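{- Let $G$ and $G'$ be graphs each containing at least one edge. Then $\operatorname{Z}(G\Box G')\ge \tau(\mathcal F_G\times\mathcal F_{G'})+1$.
   Context: All graphs are finite, simple and undirected with nonempty vertex sets. Zero forcing: given $B\subseteq V(G)$ initially filled, a filled vertex $u$ may force an unfilled vertex $w$ if $w$ is the only unfilled neighbor of $u$; $B$ is a zero forcing set if repeated forcing fills all vertices; $\operatorname{Z}(G)$ is the minimum size of a zero forcing set. A fort of $G$ is a nonempty $F\subseteq V(G)$ such that every $v\in V(G)\setminus F$ has $|N_G(v)\cap F|\neq 1$; a minimal fort is one not properly containing another fort. A hypergraph $H$ consists of a finite vertex set $V(H)$ and a set $E(H)$ of nonempty subsets (edges) whose union is $V(H)$. The fort hypergraph $\mathcal F_G$ has as edges the minimal forts of $G$ and as vertex set their union. For hypergraphs $H_1,H_2$, $H_1\times H_2$ has vertex set $V(H_1)\times V(H_2)$ and edges $\{e_1\times e_2: e_1\in E(H_1), e_2\in E(H_2)\}$. A transversal is a vertex set meeting every edge; $\tau(H)$ is the minimum size of a transversal. The Cartesian product $G\Box G'$ has vertex set $V(G)\times V(G')$, with $(u,u')\sim(v,v')$ iff ($u=v$ and $u'v'\in E(G')$) or ($u'=v'$ and $uv\in E(G)$). -}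

module Defs where

open import Data.Nat using (ℕ; _*_; _≤_)
open import Data.Bool using (Bool; true; false; _∧_; _∨_)
open import Data.Fin using (Fin; remQuot; _≟_)
open import Data.Fin.Subset using (Subset; _∈_; _∉_; _⊆_; _∩_; _∪_; ⁅_⁆; ⊤; ∣_∣; Nonempty)
open import Data.Product using (Σ; ∃; _×_; _,_; proj₁; proj₂)
open import Data.Vec using (tabulate)
open import Relation.Binary.PropositionalEquality using (_≡_; _≢_)
open import Relation.Nullary using (does)
open import Relation.Binary.Construct.Closure.ReflexiveTransitive using (Star)

Adj : ℕ → Set
Adj n = Fin n → Fin n → Bool

record Graph (n : ℕ) : Set where
  field
    adj    : Adj n
    sym    : ∀ i j → adj i j ≡ adj j i
    irrefl : ∀ i → adj i i ≡ false
open Graph public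

HasEdge : ∀ {n} → Graph n → Set
HasEdge G = ∃ λ i → ∃ λ j → adj G i j ≡ true

N : ∀ {n} → Adj n → Fin n → Subset n
N a v = tabulate (a v)

_□_ : ∀ {n m} → Graph n → Graph m → Adj (n * m)
_□_ {n} {m} G G' p q with remQuot {n} m p | remQuot {n} m q
... | (u , u') | (v , v') =
  (does (u ≟ v) ∧ adj G' u' v') ∨ (does (u' ≟ v') ∧ adj G u v)

data Force {n} (a : Adj n) (S : Subset n) : Subset n → Set where
  force : (u w : Fin n) → u ∈ S → w ∉ S → w ∈ N a u →
          (∀ v → v ∈ N a u → v ≢ w → v ∈ S) →
          Force a S (S ∪ ⁅ w ⁆)

IsZeroForcingSet : ∀ {n} → Adj n → Subset n → Set
IsZeroForcingSet a B = Star (Force a) B ⊤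

IsMinSize : ∀ {n} → (Subset n → Set) → ℕ → Set
IsMinSize P k = (∃ λ S → P S × ∣ S ∣ ≡ k) × (∀ S → P S → k ≤ ∣ S ∣)

IsZ : ∀ {n} → Adj n → ℕ → Set
IsZ a k = IsMinSize (IsZeroForcingSet a) k

IsFort : ∀ {n} → Adj n → Subset n → Set
IsFort a F = Nonempty F × (∀ v → v ∉ F → ∣ N a v ∩ F ∣ ≢ 1)

IsMinimalFort : ∀ {n} → Adj n → Subset n → Set
IsMinimalFort a F = IsFort a F × (∀ F' → IsFort a F' → F' ⊆ F → F' ≡ F)

record Hypergraph (k : ℕ) : Set₁ where
  field
    Vtx  : Fin k → Set
    Edge : Subset k → Set
open Hypergraph public

FortHyp : ∀ {n} → Graph n → Hypergraph n
FortHyp G = record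
  { Vtx  = λ x → ∃ λ F → IsMinimalFort (adj G) F × x ∈ F
  ; Edge = IsMinimalFort (adj G) }

_⊠ˢ_ : ∀ {k l} → Subset k → Subset l → Subset (k * l)
_⊠ˢ_ {k} {l} e₁ e₂ = tabulate λ p → Data.Vec.lookup e₁ (proj₁ (remQuot {k} l p)) ∧ Data.Vec.lookup e₂ (proj₂ (remQuot {k} l p))
  where import Data.Vec

_⊠_ : ∀ {k l} → Hypergraph k → Hypergraph l → Hypergraph (k * l)
_⊠_ {k} {l} H₁ H₂ = record
  { Vtx  = λ p → Vtx H₁ (proj₁ (remQuot {k} l p)) × Vtx H₂ (proj₂ (remQuot {k} l p))
  ; Edge = λ e → ∃ λ e₁ → ∃ λ e₂ → Edge H₁ e₁ × Edge H₂ e₂ × e ≡ (e₁ ⊠ˢ e₂) }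

IsTransversal : ∀ {k} → Hypergraph k → Subset k → Set
IsTransversal H T = (∀ x → x ∈ T → Vtx H x) × (∀ e → Edge H e → ∃ λ x → x ∈ T × x ∈ e)

IsTau : ∀ {k} → Hypergraph k → ℕ → Set
IsTau H t = IsMinSize (IsTransversal H) t

-- Every zero forcing set B of G □ G' meets every fort, in particular every product F₁ × F₂
-- of forts of G and G', so B ∩ V(𝓕_G × 𝓕_G') is a transversal; it remains one after deleting
-- a suitable x ∈ B. Call (i , j) interior if neither i nor j is isolated. Until the first
-- force into an interior vertex, every filled interior vertex lies in B. If that force is
-- vertical, from (k , j) to (k , l), all neighbours (d , j) of (k , j) are filled before it
-- and interior, hence in B (symmetrically for a horizontal force; if there is no such force,
-- B contains every interior vertex). Take x = (c , j) for a neighbour c of k: a product fort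
-- F₁ × F₂ through x contains (k , j), or else k ∉ F₁ has a second neighbour d ∈ F₁ besides
-- c, and then (d , j) ∈ B.
module Submission where

open import Data.Bool using (Bool; true; false; _∧_; _∨_)
import Data.Bool.Properties as Bool
open import Data.Fin using (Fin; combine; remQuot)
open import Data.Fin.Properties using (_≟_; any?; all?; remQuot-combine; combine-remQuot; combine-injective; combine-injectiveˡ; combine-injectiveʳ)
open import Data.Fin.Subset using (Subset; _∈_; _∉_; _⊆_; _∩_; _∪_; _-_; ⁅_⁆; ⊤; ∣_∣; Nonempty; Empty)
open import Data.Fin.Subset.Properties
open import Data.Nat using (ℕ; suc; _+_; _*_; _≤_; _<_)
open import Data.Nat.Properties using (≤⇒≯; ≤-<-trans; +-comm; +-monoˡ-≤; module ≤-Reasoning) renaming (_≟_ to _≟ℕ_)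
open import Data.Product using (∃; ∃₂; _×_; _,_; proj₁; proj₂)
open import Data.Sum using (_⊎_; inj₁; inj₂; [_,_]′)
open import Data.Vec using (tabulate; lookup)
open import Data.Vec.Properties using (lookup∘tabulate; []=⇒lookup; lookup⇒[]=; ≡-dec)
open import Function using (_∘_; id)
open import Relation.Binary.Construct.Closure.ReflexiveTransitive using (Star; ε; _◅_)
open import Relation.Binary.PropositionalEquality using (_≡_; _≢_; refl; sym; trans; cong; cong₂; subst)
open import Relation.Nullary using (Dec; yes; no; ¬_; does; contradiction; ¬?; _×-dec_; _→-dec_)
open import Relation.Nullary.Decidable using (map′; dec-true; decidable-stable)
open import Level using (0ℓ)
open import Relation.Unary using (Pred; Decidable)

open import Defs renaming (sym to adj-sym)

∧≡true⁻ : ∀ {a b} → a ∧ b ≡ true → a ≡ true × b ≡ true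
∧≡true⁻ {true} b≡true = refl , b≡true

∈-tabulate⁺ : ∀ {n} {f : Fin n → Bool} {x} → f x ≡ true → x ∈ tabulate f
∈-tabulate⁺ {f = f} {x} fx = lookup⇒[]= x (tabulate f) (trans (lookup∘tabulate f x) fx)

∈-tabulate⁻ : ∀ {n} {f : Fin n → Bool} {x} → x ∈ tabulate f → f x ≡ true
∈-tabulate⁻ {f = f} {x} x∈ = trans (sym (lookup∘tabulate f x)) ([]=⇒lookup x∈)

select : ∀ {n ℓ} {P : Pred (Fin n) ℓ} → Decidable P → Subset n
select P? = tabulate (does ∘ P?)

∈-select⁺ : ∀ {n ℓ} {P : Pred (Fin n) ℓ} (P? : Decidable P) {x} → P x → x ∈ select P?
∈-select⁺ P? {x} px = ∈-tabulate⁺ (dec-true (P? x) px)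

∈-select⁻ : ∀ {n ℓ} {P : Pred (Fin n) ℓ} (P? : Decidable P) {x} → x ∈ select P? → P x
∈-select⁻ {P = P} P? {x} x∈ = witness (P? x) (∈-tabulate⁻ x∈)
  where
  witness : (px? : Dec (P x)) → does px? ≡ true → P x
  witness (yes px) _ = px

x∈p⇒0<∣p∣ : ∀ {n} {p : Subset n} {x} → x ∈ p → 0 < ∣ p ∣
x∈p⇒0<∣p∣ {p = p} {x} x∈p = subst (_≤ ∣ p ∣) (∣⁅x⁆∣≡1 x)
  (p⊆q⇒∣p∣≤∣q∣ λ y∈⁅x⁆ → subst (_∈ p) (sym (x∈⁅y⁆⇒x≡y x y∈⁅x⁆)) x∈p)

module _ {n : ℕ} {p : Subset n} where

  ∣p∣≡1⇒nonempty : ∣ p ∣ ≡ 1 → Nonempty p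
  ∣p∣≡1⇒nonempty ∣p∣≡1 with nonempty? p
  ... | yes ne = ne
  ... | no empty =
    contradiction (trans (sym ∣p∣≡1) (trans (cong ∣_∣ (Empty-unique empty)) (∣⊥∣≡0 n))) λ ()

  ∣p∣≡1⇒x≡y : ∀ {x y} → ∣ p ∣ ≡ 1 → x ∈ p → y ∈ p → x ≡ y
  ∣p∣≡1⇒x≡y {x} {y} ∣p∣≡1 x∈p y∈p with x ≟ y
  ... | yes x≡y = x≡y
  ... | no x≢y = contradiction (subst (∣ p - x ∣ <_) ∣p∣≡1 (x∈p⇒∣p-x∣<∣p∣ x∈p))
                   (≤⇒≯ (x∈p⇒0<∣p∣ (x∈p∧x≢y⇒x∈p-y y∈p (x≢y ∘ sym))))

  ∣p∣≢1⇒another : ∀ {x} → ∣ p ∣ ≢ 1 → x ∈ p → ∃ λ y → y ∈ p × y ≢ x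
  ∣p∣≢1⇒another {x} ∣p∣≢1 x∈p with any? (λ y → y ∈? p ×-dec ¬? (y ≟ x))
  ... | yes another = another
  ... | no none = contradiction (trans (cong ∣_∣ p≡⁅x⁆) (∣⁅x⁆∣≡1 x)) ∣p∣≢1
    where
    p≡⁅x⁆ : p ≡ ⁅ x ⁆
    p≡⁅x⁆ = ⊆-antisym
      (λ {y} y∈p → subst (_∈ ⁅ x ⁆) (sym (decidable-stable (y ≟ x) λ y≢x → none (y , y∈p , y≢x))) (x∈⁅x⁆ x))
      (λ y∈⁅x⁆ → subst (_∈ p) (sym (x∈⁅y⁆⇒x≡y x y∈⁅x⁆)) x∈p)

  another⇒∣p∣≢1 : (∀ {x} → x ∈ p → ∃ λ y → y ∈ p × y ≢ x) → ∣ p ∣ ≢ 1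
  another⇒∣p∣≢1 another ∣p∣≡1 =
    let (x , x∈p) = ∣p∣≡1⇒nonempty ∣p∣≡1
        (y , y∈p , y≢x) = another x∈p
    in y≢x (∣p∣≡1⇒x≡y ∣p∣≡1 y∈p x∈p)

∈N⁺ : ∀ {k} (a : Adj k) {v y} → a v y ≡ true → y ∈ N a v
∈N⁺ a = ∈-tabulate⁺

∈N⁻ : ∀ {k} (a : Adj k) {v y} → y ∈ N a v → a v y ≡ true
∈N⁻ a = ∈-tabulate⁻

HasSecondNeighbours : ∀ {k} → Adj k → Subset k → Set
HasSecondNeighbours a F =
  ∀ {v y} → v ∉ F → y ∈ N a v → y ∈ F → ∃ λ z → z ∈ N a v × z ∈ F × z ≢ y

module _ {k : ℕ} {a : Adj k} where

  fort⇒hasSecondNeighbours : ∀ {F} → IsFort a F → HasSecondNeighbours a F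
  fort⇒hasSecondNeighbours (_ , fort) v∉F y∈N y∈F =
    let (z , z∈N∩F , z≢y) = ∣p∣≢1⇒another (fort _ v∉F) (x∈p∩q⁺ (y∈N , y∈F))
        (z∈N , z∈F) = x∈p∩q⁻ _ _ z∈N∩F
    in z , z∈N , z∈F , z≢y

  hasSecondNeighbours⇒fort : ∀ {F} → Nonempty F → HasSecondNeighbours a F → IsFort a F
  hasSecondNeighbours⇒fort ne second = ne , λ v v∉F → another⇒∣p∣≢1 λ y∈N∩F →
    let (y∈N , y∈F) = x∈p∩q⁻ _ _ y∈N∩F
        (z , z∈N , z∈F , z≢y) = second v∉F y∈N y∈F
    in z , x∈p∩q⁺ (z∈N , z∈F) , z≢y

  force-preserves-disjointness : ∀ {F S S′} → IsFort a F → Force a S S′ →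
                                 Empty (S ∩ F) → Empty (S′ ∩ F)
  force-preserves-disjointness {F} {S} fort (force u w u∈S _ w∈N others) S∩F≡∅ (y , y∈S′∩F)
    with x∈p∩q⁻ _ F y∈S′∩F
  ... | y∈S∪w , y∈F with x∈p∪q⁻ S ⁅ w ⁆ y∈S∪w
  ...   | inj₁ y∈S = S∩F≡∅ (y , x∈p∩q⁺ (y∈S , y∈F))
  ...   | inj₂ y∈⁅w⁆ =
    let (z , z∈N , z∈F , z≢w) = fort⇒hasSecondNeighbours fort u∉F w∈N w∈F
    in S∩F≡∅ (z , x∈p∩q⁺ (others z z∈N z≢w , z∈F))
    where
    w∈F : w ∈ F
    w∈F = subst (_∈ F) (x∈⁅y⁆⇒x≡y w y∈⁅w⁆) y∈F
    u∉F : u ∉ F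
    u∉F u∈F = S∩F≡∅ (u , x∈p∩q⁺ (u∈S , u∈F))

  forcing-preserves-disjointness : ∀ {F S S′} → IsFort a F → Star (Force a) S S′ →
                                   Empty (S ∩ F) → Empty (S′ ∩ F)
  forcing-preserves-disjointness fort ε = id
  forcing-preserves-disjointness fort (f ◅ fs) =
    forcing-preserves-disjointness fort fs ∘ force-preserves-disjointness fort f

  zeroForcingSet-meets-fort : ∀ {B F} → IsZeroForcingSet a B → IsFort a F → Nonempty (B ∩ F)
  zeroForcingSet-meets-fort {B} {F} zfs fort@((x , x∈F) , _) with nonempty? (B ∩ F)
  ... | yes meets = meets
  ... | no B∩F≡∅ =
    contradiction (x , x∈p∩q⁺ (∈⊤ , x∈F)) (forcing-preserves-disjointness fort zfs B∩F≡∅)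

isFort? : ∀ {k} (a : Adj k) → Decidable (IsFort a)
isFort? a F = nonempty? F ×-dec all? λ v → ¬? (v ∈? F) →-dec ¬? (∣ N a v ∩ F ∣ ≟ℕ 1)

isMinimalFort? : ∀ {k} (a : Adj k) → Decidable (IsMinimalFort a)
isMinimalFort? {k} a F =
  isFort? a F ×-dec map′ noSmaller⇒minimal minimal⇒noSmaller (¬? (anySubset? smallerFort?))
  where
  SmallerFort : Pred (Subset k) 0ℓ
  SmallerFort F′ = IsFort a F′ × F′ ⊆ F × F′ ≢ F

  smallerFort? : Decidable SmallerFort
  smallerFort? F′ = isFort? a F′ ×-dec F′ ⊆? F ×-dec ¬? (≡-dec Bool._≟_ F′ F)

  noSmaller⇒minimal : ¬ (∃ SmallerFort) → ∀ F′ → IsFort a F′ → F′ ⊆ F → F′ ≡ F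
  noSmaller⇒minimal none F′ fort F′⊆F =
    decidable-stable (≡-dec Bool._≟_ F′ F) λ F′≢F → none (F′ , fort , F′⊆F , F′≢F)

  minimal⇒noSmaller : (∀ F′ → IsFort a F′ → F′ ⊆ F → F′ ≡ F) → ¬ (∃ SmallerFort)
  minimal⇒noSmaller minimal (F′ , fort , F′⊆F , F′≢F) = F′≢F (minimal F′ fort F′⊆F)

FortHyp-vertex? : ∀ {k} (G : Graph k) → Decidable (Vtx (FortHyp G))
FortHyp-vertex? G x = anySubset? λ F → isMinimalFort? (adj G) F ×-dec x ∈? F

⊠-vertex? : ∀ {k l} {H₁ : Hypergraph k} {H₂ : Hypergraph l} →
            Decidable (Vtx H₁) → Decidable (Vtx H₂) → Decidable (Vtx (H₁ ⊠ H₂))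
⊠-vertex? {k} {l} V₁? V₂? p = V₁? (proj₁ (remQuot {k} l p)) ×-dec V₂? (proj₂ (remQuot {k} l p))

data CombineView {n m : ℕ} : Fin (n * m) → Set where
  combined : (i : Fin n) (j : Fin m) → CombineView (combine i j)

combineView : ∀ {n} m (p : Fin (n * m)) → CombineView p
combineView {n} m p = subst (CombineView {n} {m}) (combine-remQuot {n} m p) (combined _ _)

∈-⊠ˢ⁺ : ∀ {k l} {e₁ : Subset k} {e₂ : Subset l} {i j} → i ∈ e₁ → j ∈ e₂ → combine i j ∈ e₁ ⊠ˢ e₂
∈-⊠ˢ⁺ {e₁ = e₁} {e₂} {i} {j} i∈e₁ j∈e₂ = ∈-tabulate⁺
  (subst (λ r → lookup e₁ (proj₁ r) ∧ lookup e₂ (proj₂ r) ≡ true) (sym (remQuot-combine i j))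
         (cong₂ _∧_ ([]=⇒lookup i∈e₁) ([]=⇒lookup j∈e₂)))

∈-⊠ˢ⁻ : ∀ {k l} (e₁ : Subset k) (e₂ : Subset l) {p} →
        p ∈ e₁ ⊠ˢ e₂ → proj₁ (remQuot {k} l p) ∈ e₁ × proj₂ (remQuot {k} l p) ∈ e₂
∈-⊠ˢ⁻ e₁ e₂ p∈ = let (b₁ , b₂) = ∧≡true⁻ (∈-tabulate⁻ p∈) in lookup⇒[]= _ e₁ b₁ , lookup⇒[]= _ e₂ b₂

combine-∈-⊠ˢ⁻ : ∀ {k l} (e₁ : Subset k) (e₂ : Subset l) {i j} → combine i j ∈ e₁ ⊠ˢ e₂ → i ∈ e₁ × j ∈ e₂
combine-∈-⊠ˢ⁻ e₁ e₂ {i} {j} ij∈ =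
  subst (λ r → proj₁ r ∈ e₁ × proj₂ r ∈ e₂) (remQuot-combine i j) (∈-⊠ˢ⁻ e₁ e₂ ij∈)

adj-symmetric : ∀ {n} (G : Graph n) {i j} → adj G i j ≡ true → adj G j i ≡ true
adj-symmetric G {i} {j} i~j = trans (adj-sym G j i) i~j

adj⇒≢ : ∀ {n} (G : Graph n) {i j} → adj G i j ≡ true → i ≢ j
adj⇒≢ G {i} i~i refl = contradiction (trans (sym i~i) (irrefl G i)) λ ()

NonIsolated : ∀ {k} → Adj k → Fin k → Set
NonIsolated a i = ∃ λ c → a i c ≡ true

nonIsolated? : ∀ {k} (a : Adj k) → Decidable (NonIsolated a)
nonIsolated? a i = any? λ c → a i c Bool.≟ true

module _ {n m : ℕ} (G : Graph n) (G' : Graph m) where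

  private
    adjacent : Fin n × Fin m → Fin n × Fin m → Bool
    adjacent (i , j) (k , l) = (does (i ≟ k) ∧ adj G' j l) ∨ (does (j ≟ l) ∧ adj G i k)

    □-remQuot : ∀ p q → (G □ G') p q ≡ adjacent (remQuot {n} m p) (remQuot {n} m q)
    □-remQuot p q with remQuot {n} m p | remQuot {n} m q
    ... | _ | _ = refl

  □-combine : ∀ i j k l → (G □ G') (combine i j) (combine k l) ≡
              (does (i ≟ k) ∧ adj G' j l) ∨ (does (j ≟ l) ∧ adj G i k)
  □-combine i j k l = trans (□-remQuot _ _) (cong₂ adjacent (remQuot-combine i j) (remQuot-combine k l))

  □-adj⁻ : ∀ i j k l → (G □ G') (combine i j) (combine k l) ≡ true →
           (i ≡ k × adj G' j l ≡ true) ⊎ (j ≡ l × adj G i k ≡ true)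
  □-adj⁻ i j k l ij~kl rewrite □-combine i j k l with i ≟ k | j ≟ l | adj G' j l
  ... | yes i≡k | _       | true  = inj₁ (i≡k , refl)
  ... | yes _   | yes j≡l | false = inj₂ (j≡l , ij~kl)
  ... | no _    | yes j≡l | _     = inj₂ (j≡l , ij~kl)

  □-adjᵛ : ∀ i j l → adj G' j l ≡ true → (G □ G') (combine i j) (combine i l) ≡ true
  □-adjᵛ i j l j~l rewrite □-combine i j i l | dec-true (i ≟ i) refl | j~l = refl

  □-adjʰ : ∀ i j k → adj G i k ≡ true → (G □ G') (combine i j) (combine k j) ≡ true
  □-adjʰ i j k i~k rewrite □-combine i j k j | dec-true (j ≟ j) refl | i~k = Bool.∨-zeroʳ _

  ⊠ˢ-fort : ∀ {F₁ F₂} → IsFort (adj G) F₁ → IsFort (adj G') F₂ → IsFort (G □ G') (F₁ ⊠ˢ F₂)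
  ⊠ˢ-fort {F₁} {F₂} fort₁@((x₁ , x₁∈F₁) , _) fort₂@((x₂ , x₂∈F₂) , _) =
    hasSecondNeighbours⇒fort (combine x₁ x₂ , ∈-⊠ˢ⁺ x₁∈F₁ x₂∈F₂) second
    where
    second : HasSecondNeighbours (G □ G') (F₁ ⊠ˢ F₂)
    second {v} {y} v∉F y∈N y∈F with combineView {n} m v | combineView {n} m y
    ... | combined i j | combined k l with □-adj⁻ i j k l (∈N⁻ (G □ G') y∈N) | combine-∈-⊠ˢ⁻ F₁ F₂ y∈F
    ... | inj₁ (refl , j~l) | i∈F₁ , l∈F₂ =
      let (l′ , l′∈N , l′∈F₂ , l′≢l) =
            fort⇒hasSecondNeighbours fort₂ (v∉F ∘ ∈-⊠ˢ⁺ i∈F₁) (∈N⁺ (adj G') j~l) l∈F₂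
      in combine i l′ , ∈N⁺ (G □ G') (□-adjᵛ i j l′ (∈N⁻ (adj G') l′∈N)) ,
         ∈-⊠ˢ⁺ i∈F₁ l′∈F₂ , l′≢l ∘ combine-injectiveʳ i l′ i l
    ... | inj₂ (refl , i~k) | k∈F₁ , j∈F₂ =
      let (k′ , k′∈N , k′∈F₁ , k′≢k) =
            fort⇒hasSecondNeighbours fort₁ (v∉F ∘ λ i∈F₁ → ∈-⊠ˢ⁺ i∈F₁ j∈F₂) (∈N⁺ (adj G) i~k) k∈F₁
      in combine k′ j , ∈N⁺ (G □ G') (□-adjʰ i j k′ (∈N⁻ (adj G) k′∈N)) ,
         ∈-⊠ˢ⁺ k′∈F₁ j∈F₂ , k′≢k ∘ combine-injectiveˡ k′ j k j

  Interior : Fin n → Fin m → Set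
  Interior i j = NonIsolated (adj G) i × NonIsolated (adj G') j

  InteriorSubset : Subset (n * m) → Subset (n * m) → Set
  InteriorSubset S B = ∀ {i j} → Interior i j → combine i j ∈ S → combine i j ∈ B

  ContainsHorizontalStar : Subset (n * m) → Set
  ContainsHorizontalStar B = ∃₂ λ (i : Fin n) (j : Fin m) →
    NonIsolated (adj G) i × combine i j ∈ B × (∀ {d} → adj G i d ≡ true → combine d j ∈ B)

  ContainsVerticalStar : Subset (n * m) → Set
  ContainsVerticalStar B = ∃₂ λ (i : Fin n) (j : Fin m) →
    NonIsolated (adj G') j × combine i j ∈ B × (∀ {e} → adj G' j e ≡ true → combine i e ∈ B)

  interiorSubset-∪ : ∀ {S B k l} → ¬ Interior k l → InteriorSubset S B →
                     InteriorSubset (S ∪ ⁅ combine k l ⁆) B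
  interiorSubset-∪ {S} {k = k} {l} ¬interior S⊆B {i} {j} interior ij∈ with x∈p∪q⁻ S _ ij∈
  ... | inj₁ ij∈S = S⊆B interior ij∈S
  ... | inj₂ ij∈⁅kl⁆ with combine-injective i j k l (x∈⁅y⁆⇒x≡y _ ij∈⁅kl⁆)
  ...   | refl , refl = contradiction interior ¬interior

  interiorForce⇒star : ∀ {S B u k l} → InteriorSubset S B → Interior k l → u ∈ S →
                       combine k l ∈ N (G □ G') u →
                       (∀ v → v ∈ N (G □ G') u → v ≢ combine k l → v ∈ S) →
                       ContainsHorizontalStar B ⊎ ContainsVerticalStar B
  interiorForce⇒star {u = u} {k} {l} S⊆B (k-nonIsolated , l-nonIsolated) u∈S kl∈N others
    with combineView {n} m u
  ... | combined i j with □-adj⁻ i j k l (∈N⁻ (G □ G') kl∈N)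
  ... | inj₁ (refl , j~l) = inj₁ (i , j , k-nonIsolated , S⊆B (k-nonIsolated , l , j~l) u∈S , star)
    where
    star : ∀ {d} → adj G i d ≡ true → combine d j ∈ _
    star {d} i~d = S⊆B ((i , adj-symmetric G i~d) , l , j~l)
      (others _ (∈N⁺ (G □ G') (□-adjʰ i j d i~d)) (adj⇒≢ G i~d ∘ sym ∘ combine-injectiveˡ d j i l))
  ... | inj₂ (refl , i~k) = inj₂ (i , j , l-nonIsolated , S⊆B ((k , i~k) , l-nonIsolated) u∈S , star)
    where
    star : ∀ {e} → adj G' j e ≡ true → combine i e ∈ _
    star {e} j~e = S⊆B ((k , i~k) , j , adj-symmetric G' j~e)
      (others _ (∈N⁺ (G □ G') (□-adjᵛ i j e j~e)) (adj⇒≢ G i~k ∘ combine-injectiveˡ i e k j))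

  forcing⇒star : ∀ {S B} → HasEdge G → HasEdge G' → Star (Force (G □ G')) S ⊤ →
                 InteriorSubset S B → ContainsHorizontalStar B ⊎ ContainsVerticalStar B
  forcing⇒star (a , b , a~b) (a′ , b′ , a′~b′) ε ⊤⊆B =
    inj₁ (a , a′ , (b , a~b) , ⊤⊆B ((b , a~b) , b′ , a′~b′) ∈⊤ ,
          λ a~d → ⊤⊆B ((a , adj-symmetric G a~d) , b′ , a′~b′) ∈⊤)
  forcing⇒star hasEdge hasEdge′ (force u w u∈S _ w∈N others ◅ forces) S⊆B with combineView {n} m w
  ... | combined k l with nonIsolated? (adj G) k ×-dec nonIsolated? (adj G') l
  ...   | yes interior = interiorForce⇒star S⊆B interior u∈S w∈N others
  ...   | no ¬interior = forcing⇒star hasEdge hasEdge′ forces (interiorSubset-∪ ¬interior S⊆B)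

  Redundant : Subset (n * m) → Fin (n * m) → Set
  Redundant B x = ∀ {F₁ F₂} → IsFort (adj G) F₁ → IsFort (adj G') F₂ → x ∈ F₁ ⊠ˢ F₂ →
                  ∃ λ y → y ∈ B × y ∈ F₁ ⊠ˢ F₂ × y ≢ x

  horizontalStar⇒redundant : ∀ {B} → ContainsHorizontalStar B → ∃ λ x → x ∈ B × Redundant B x
  horizontalStar⇒redundant {B} (i , j , (c , i~c) , ij∈B , star) = combine c j , star i~c , redundant
    where
    redundant : Redundant B (combine c j)
    redundant {F₁} {F₂} fort₁ _ cj∈F with combine-∈-⊠ˢ⁻ F₁ F₂ cj∈F
    ... | c∈F₁ , j∈F₂ with i ∈? F₁
    ...   | yes i∈F₁ = combine i j , ij∈B , ∈-⊠ˢ⁺ i∈F₁ j∈F₂ , adj⇒≢ G i~c ∘ combine-injectiveˡ i j c j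
    ...   | no i∉F₁ =
      let (d , d∈N , d∈F₁ , d≢c) = fort⇒hasSecondNeighbours fort₁ i∉F₁ (∈N⁺ (adj G) i~c) c∈F₁
      in combine d j , star (∈N⁻ (adj G) d∈N) , ∈-⊠ˢ⁺ d∈F₁ j∈F₂ , d≢c ∘ combine-injectiveˡ d j c j

  verticalStar⇒redundant : ∀ {B} → ContainsVerticalStar B → ∃ λ x → x ∈ B × Redundant B x
  verticalStar⇒redundant {B} (i , j , (c , j~c) , ij∈B , star) = combine i c , star j~c , redundant
    where
    redundant : Redundant B (combine i c)
    redundant {F₁} {F₂} _ fort₂ ic∈F with combine-∈-⊠ˢ⁻ F₁ F₂ ic∈F
    ... | i∈F₁ , c∈F₂ with j ∈? F₂
    ...   | yes j∈F₂ = combine i j , ij∈B , ∈-⊠ˢ⁺ i∈F₁ j∈F₂ , adj⇒≢ G' j~c ∘ combine-injectiveʳ i j i c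
    ...   | no j∉F₂ =
      let (e , e∈N , e∈F₂ , e≢c) = fort⇒hasSecondNeighbours fort₂ j∉F₂ (∈N⁺ (adj G') j~c) c∈F₂
      in combine i e , star (∈N⁻ (adj G') e∈N) , ∈-⊠ˢ⁺ i∈F₁ e∈F₂ , e≢c ∘ combine-injectiveʳ i e i c

  redundantVertex : ∀ {B} → HasEdge G → HasEdge G' → IsZeroForcingSet (G □ G') B →
                    ∃ λ x → x ∈ B × Redundant B x
  redundantVertex hasEdge hasEdge′ zfs =
    [ horizontalStar⇒redundant , verticalStar⇒redundant ]′ (forcing⇒star hasEdge hasEdge′ zfs λ _ → id)

  vertex? : Decidable (Vtx (FortHyp G ⊠ FortHyp G'))
  vertex? = ⊠-vertex? {H₁ = FortHyp G} {H₂ = FortHyp G'} (FortHyp-vertex? G) (FortHyp-vertex? G')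

  vertices : Subset (n * m)
  vertices = select vertex?

  minimalForts-⊠ˢ⊆Vtx : ∀ {e₁ e₂ p} → IsMinimalFort (adj G) e₁ → IsMinimalFort (adj G') e₂ →
                        p ∈ e₁ ⊠ˢ e₂ → Vtx (FortHyp G ⊠ FortHyp G') p
  minimalForts-⊠ˢ⊆Vtx {e₁} {e₂} minimal₁ minimal₂ p∈e =
    let (p₁∈e₁ , p₂∈e₂) = ∈-⊠ˢ⁻ e₁ e₂ p∈e in (e₁ , minimal₁ , p₁∈e₁) , (e₂ , minimal₂ , p₂∈e₂)

  redundant⇒transversal : ∀ {B x} → IsZeroForcingSet (G □ G') B → Redundant B x →
                          IsTransversal (FortHyp G ⊠ FortHyp G') ((B - x) ∩ vertices)
  redundant⇒transversal {B} {x} zfs redundant =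
    (λ _ p∈T → ∈-select⁻ vertex? (proj₂ (x∈p∩q⁻ _ _ p∈T))) , meets
    where
    kept : ∀ {e₁ e₂ y} → IsMinimalFort (adj G) e₁ → IsMinimalFort (adj G') e₂ →
           y ∈ B → y ≢ x → y ∈ e₁ ⊠ˢ e₂ → y ∈ (B - x) ∩ vertices
    kept minimal₁ minimal₂ y∈B y≢x y∈e =
      x∈p∩q⁺ (x∈p∧x≢y⇒x∈p-y y∈B y≢x , ∈-select⁺ vertex? (minimalForts-⊠ˢ⊆Vtx minimal₁ minimal₂ y∈e))

    meets : ∀ e → Edge (FortHyp G ⊠ FortHyp G') e → ∃ λ y → y ∈ (B - x) ∩ vertices × y ∈ e
    meets _ (e₁ , e₂ , minimal₁@(fort₁ , _) , minimal₂@(fort₂ , _) , refl)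
      with zeroForcingSet-meets-fort zfs (⊠ˢ-fort fort₁ fort₂)
    ... | y , y∈B∩e with x∈p∩q⁻ B _ y∈B∩e
    ...   | y∈B , y∈e with y ≟ x
    ...     | no y≢x = y , kept minimal₁ minimal₂ y∈B y≢x y∈e , y∈e
    ...     | yes refl =
      let (y′ , y′∈B , y′∈e , y′≢y) = redundant fort₁ fort₂ y∈e
      in y′ , kept minimal₁ minimal₂ y′∈B y′≢y y′∈e , y′∈e

lemma4p4 : ∀ {n m} (G : Graph n) (G' : Graph m) → HasEdge G → HasEdge G' →
           ∀ (z t : ℕ) → IsZ (G □ G') z → IsTau (FortHyp G ⊠ FortHyp G') t →
           t + 1 ≤ z
lemma4p4 G G' hasEdge hasEdge′ z t ((B , zfs , ∣B∣≡z) , _) (_ , τ-minimal)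
  with redundantVertex G G' hasEdge hasEdge′ zfs
... | x , x∈B , x-redundant = begin
  t + 1       ≤⟨ +-monoˡ-≤ 1 (τ-minimal T (redundant⇒transversal G G' zfs x-redundant)) ⟩
  ∣ T ∣ + 1   ≡⟨ +-comm ∣ T ∣ 1 ⟩
  suc ∣ T ∣   ≤⟨ ≤-<-trans (∣p∩q∣≤∣p∣ (B - x) _) (x∈p⇒∣p-x∣<∣p∣ x∈B) ⟩
  ∣ B ∣       ≡⟨ ∣B∣≡z ⟩
  z           ∎
  where
  open ≤-Reasoning
  T : Subset _
  T = (B - x) ∩ vertices G G'
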